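{- Let $m,n\geq 1$. For $\pi=\pi_1\cdots\pi_{m+n}\in\mathcal{S}_{m+n}$ define \[ c_{m,n}(\pi):=\sum_{i=1}^{m}\bigl[\pi_i \text{ is among the } m+1-i \text{ smallest elements of } \{\pi_i,\pi_{i+1},\dots,\pi_{m+n}\}\bigr], \] where $[\phi]=1$ if $\phi$ is true and $0$ otherwise. For $0\le k\le m$ let \[ c_{m,n,k}:=\bigl|\{\pi\in\mathcal{S}_{m+n}: c_{m,n}(\pi)=m-k\}\bigr|. \] Then \[ c_{m,n,k}=n^k\, {m+1 \brack k+1}\, n!, \] where ${s\brack t}$ denotes the unsigned Stirling number of the first kind, i.e. the number of permutations of $s$ elements with exactly $t$ disjoint cycles.
   Context: $\mathcal{S}_{N}$ denotes the set of permutations of $\{1,\dots,N\}$, written in one-line notation $\pi=\pi_1\pi_2\cdots\pi_N$. -}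

module Defs where

open import Data.Nat using (ℕ; zero; suc; _+_; _*_; _<ᵇ_; _≤ᵇ_; _≡ᵇ_)
open import Data.Bool using (Bool; true; false; _∧_; if_then_else_)
open import Data.Fin using (Fin; toℕ)
open import Data.Fin.Properties using (_≟_)
open import Data.Vec using (Vec; []; _∷_; lookup; toList; allFin)
open import Data.List using (List; []; _∷_; length; filterᵇ; map; concatMap; upTo; foldr)
open import Relation.Nullary using (does; ¬_)

allᵇ : {A : Set} → (A → Bool) → List A → Bool
allᵇ p = foldr (λ x b → p x ∧ b) true

allVecs : (N k : ℕ) → List (Vec (Fin N) k)
allVecs N zero = [] ∷ []
allVecs N (suc k) = concatMap (λ x → map (x ∷_) (allVecs N k)) (Data.Vec.toList (allFin N))

distinct : {N : ℕ} → List (Fin N) → Bool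
distinct [] = true
distinct (x ∷ xs) = allᵇ (λ y → Data.Bool.not (does (x ≟ y))) xs ∧ distinct xs

-- one-line notation π₁⋯π_N (with values 0..N-1): a permutation of {1..N}
-- is a vector of length N over Fin N with pairwise distinct entries
isPerm : {N : ℕ} → Vec (Fin N) N → Bool
isPerm v = distinct (toList v)

SymGroup : (N : ℕ) → List (Vec (Fin N) N)
SymGroup N = filterᵇ isPerm (allVecs N N)

countLess : ℕ → List ℕ → ℕ
countLess x [] = 0
countLess x (y ∷ ys) = if y <ᵇ x then suc (countLess x ys) else countLess x ys

-- cAux r (π_i ∷ π_{i+1} ∷ ⋯ ∷ π_N) with r = m+1-i sums, for the first r positions,
-- [π_i is among the r smallest elements of {π_i,…,π_N}], i.e. rank(π_i) ≤ r,
-- i.e. #{j > i : π_j < π_i} < r; r decreases by 1 with each position.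
cAux : ℕ → List ℕ → ℕ
cAux zero xs = 0
cAux (suc r) [] = 0
cAux (suc r) (x ∷ xs) =
  (if countLess x xs <ᵇ suc r then 1 else 0) + cAux r xs

c : (m n : ℕ) → Vec (Fin (m + n)) (m + n) → ℕ
c m n π = cAux m (map toℕ (toList π))

cmnk : (m n k : ℕ) → ℕ
cmnk m n k = length (filterᵇ (λ π → c m n π ≡ᵇ (m Data.Nat.∸ k)) (SymGroup (m + n)))

iter : {N : ℕ} → Vec (Fin N) N → ℕ → Fin N → Fin N
iter π zero i = i
iter π (suc t) i = lookup π (iter π t i)

isCycleMin : {N : ℕ} → Vec (Fin N) N → Fin N → Bool
isCycleMin {N} π i = allᵇ (λ t → toℕ i ≤ᵇ toℕ (iter π (suc t) i)) (upTo N)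

-- number of disjoint cycles of π (each cycle counted via its least element)
cycles : {N : ℕ} → Vec (Fin N) N → ℕ
cycles {N} π = length (filterᵇ (isCycleMin π) (toList (allFin N)))

stirling1 : ℕ → ℕ → ℕ
stirling1 s t = length (filterᵇ (λ π → cycles π ≡ᵇ t) (SymGroup s))

-- Write the first entry of π ∈ S_{N+1} as x and standardise the remaining entries to σ ∈ S_N. In
-- 0-based values exactly x of the later entries are smaller than x, so the first position contributes
-- [x < m] to c_{m,n}(π) and the others contribute c_{m-1,n}(σ). Summing over x, the distribution
-- D_m(j) of c_{m,n} over S_{m+n} satisfies D_m(j) = m D_{m-1}(j-1) + n D_{m-1}(j).
--
-- Counting cycles by their minima is turned into counting them by their maxima by conjugating with
-- i ↦ N-1-i. The position 0 is a cycle maximum of π exactly when π fixes it, and cutting 0 out of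
-- its cycle (and lowering every value by one) keeps all other cycle maxima, which gives the
-- recurrence [s+1, t] = [s, t-1] + s [s, t]. Induction on the two recurrences yields the formula.
module Submission where

open import Data.Bool using (Bool; true; false; T; T?; not; _∧_; if_then_else_)
open import Data.Bool.Properties using (T-≡; T-∧)
open import Data.Empty using (⊥-elim)
open import Data.Fin using (Fin; zero; suc; toℕ; punchIn; punchOut; opposite)
import Data.Fin.Properties as Finₚ
open import Data.List as List using (List; []; _∷_; _++_; length; map; concatMap; filterᵇ; upTo)
open import Data.List.Membership.Propositional using (_∈_)
import Data.List.Membership.Propositional.Properties as ∈ₚ
open import Data.List.Membership.Propositional.Properties.WithK using (unique∧set⇒bag)
import Data.List.Properties as Listₚ
open import Data.List.Relation.Binary.BagAndSetEquality using (∼bag⇒↭)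
open import Data.List.Relation.Binary.Permutation.Propositional.Properties using (filter-↭; ↭-length)
open import Data.List.Relation.Unary.All as All using (All; []; _∷_)
import Data.List.Relation.Unary.All.Properties as Allₚ
open import Data.List.Relation.Unary.AllPairs using ([]; _∷_)
open import Data.List.Relation.Unary.Any as Any using (here; there)
open import Data.List.Relation.Unary.Unique.Propositional using (Unique)
import Data.List.Relation.Unary.Unique.Propositional.Properties as Uniqueₚ
open import Data.Nat
  using (ℕ; zero; suc; _+_; _*_; _∸_; _^_; _!; _≤_; _<_; _≥_; _<ᵇ_; _≤ᵇ_; _≡ᵇ_; z≤n; s≤s; NonZero; >-nonZero)
open import Data.Nat.DivMod using (_%_; _/_; m≡m%n+[m/n]*n; m%n<n)
open import Data.Nat.ListAction using (sum)
open import Data.Nat.Properties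
open import Data.Nat.Tactic.RingSolver using (solve-∀)
open import Data.Product using (∃; _×_; _,_; proj₁; proj₂)
open import Data.Sum using (_⊎_; inj₁; inj₂)
open import Data.Vec as Vec using (Vec; []; _∷_; lookup)
open import Data.Vec.Membership.Propositional.Properties using (∈-lookup; ∈-toList⁺)
import Data.Vec.Properties as Vecₚ
import Data.Vec.Relation.Unary.All.Properties as VAllₚ
open import Function using (_∘_; _⇔_; mk⇔; Equivalence)
open import Function.Definitions using (Injective)
open import Relation.Binary.PropositionalEquality
open import Relation.Nullary using (does; yes; no)

open import Defs

private variable
  A B : Set

fromBool : Bool → ℕ
fromBool b = if b then 1 else 0

count : (A → Bool) → List A → ℕ
count p xs = length (filterᵇ p xs)

distribution : (A → ℕ) → List A → ℕ → ℕ
distribution f xs j = count (λ a → f a ≡ᵇ j) xs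

count-∷ : (p : A → Bool) (x : A) (xs : List A) → count p (x ∷ xs) ≡ fromBool (p x) + count p xs
count-∷ p x xs with p x
... | true = refl
... | false = refl

count-++ : (p : A → Bool) (xs ys : List A) → count p (xs ++ ys) ≡ count p xs + count p ys
count-++ p xs ys = trans (cong length (Listₚ.filter-++ (T? ∘ p) xs ys)) (Listₚ.length-++ (filterᵇ p xs))

count-map : (p : A → Bool) (f : B → A) (xs : List B) → count p (map f xs) ≡ count (p ∘ f) xs
count-map p f [] = refl
count-map p f (x ∷ xs) = begin
  count p (f x ∷ map f xs)                ≡⟨ count-∷ p (f x) (map f xs) ⟩
  fromBool (p (f x)) + count p (map f xs) ≡⟨ cong (fromBool (p (f x)) +_) (count-map p f xs) ⟩
  fromBool (p (f x)) + count (p ∘ f) xs   ≡⟨ count-∷ (p ∘ f) x xs ⟨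
  count (p ∘ f) (x ∷ xs)                  ∎
  where open ≡-Reasoning

count-concatMap : (p : A → Bool) (f : B → List A) (xs : List B) →
                  count p (concatMap f xs) ≡ sum (map (count p ∘ f) xs)
count-concatMap p f [] = refl
count-concatMap p f (x ∷ xs) =
  trans (count-++ p (f x) (concatMap f xs)) (cong (count p (f x) +_) (count-concatMap p f xs))

count-cong : {p q : A → Bool} (xs : List A) → (∀ {x} → x ∈ xs → p x ≡ q x) → count p xs ≡ count q xs
count-cong [] _ = refl
count-cong {p = p} {q} (x ∷ xs) p≡q = begin
  count p (x ∷ xs)              ≡⟨ count-∷ p x xs ⟩
  fromBool (p x) + count p xs   ≡⟨ cong₂ _+_ (cong fromBool (p≡q (here refl))) (count-cong xs (p≡q ∘ there)) ⟩
  fromBool (q x) + count q xs   ≡⟨ count-∷ q x xs ⟨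
  count q (x ∷ xs)              ∎
  where open ≡-Reasoning

count-false : (xs : List A) → count (λ _ → false) xs ≡ 0
count-false [] = refl
count-false (x ∷ xs) = count-false xs

count-true : (xs : List A) → count (λ _ → true) xs ≡ length xs
count-true [] = refl
count-true (x ∷ xs) = cong suc (count-true xs)

count-∼set : (p : A → Bool) {xs ys : List A} → Unique xs → Unique ys → (∀ {z} → z ∈ xs ⇔ z ∈ ys) →
             count p xs ≡ count p ys
count-∼set p xs! ys! xs∼ys = ↭-length (filter-↭ (T? ∘ p) (∼bag⇒↭ (unique∧set⇒bag xs! ys! xs∼ys)))

count-∘-bijection : (p : A → Bool) (φ ψ : A → A) {xs : List A} → Unique xs →
  (∀ x → ψ (φ x) ≡ x) → (∀ x → φ (ψ x) ≡ x) →
  (∀ {x} → x ∈ xs → φ x ∈ xs) → (∀ {x} → x ∈ xs → ψ x ∈ xs) →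
  count (p ∘ φ) xs ≡ count p xs
count-∘-bijection p φ ψ {xs} xs! ψφ φψ φ-closed ψ-closed = begin
  count (p ∘ φ) xs   ≡⟨ count-map p φ xs ⟨
  count p (map φ xs) ≡⟨ count-∼set p (Uniqueₚ.map⁺ φ-injective xs!) xs! (mk⇔ to from) ⟩
  count p xs         ∎
  where
  open ≡-Reasoning
  φ-injective : ∀ {x y} → φ x ≡ φ y → x ≡ y
  φ-injective {x} {y} φx≡φy = trans (sym (ψφ x)) (trans (cong ψ φx≡φy) (ψφ y))
  to : ∀ {z} → z ∈ map φ xs → z ∈ xs
  to z∈ with x , x∈ , refl ← ∈ₚ.∈-map⁻ φ z∈ = φ-closed x∈
  from : ∀ {z} → z ∈ xs → z ∈ map φ xs
  from {z} z∈ = subst (_∈ map φ xs) (φψ z) (∈ₚ.∈-map⁺ φ (ψ-closed z∈))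

sum-map-const : (c : ℕ) (xs : List A) → sum (map (λ _ → c) xs) ≡ length xs * c
sum-map-const c [] = refl
sum-map-const c (x ∷ xs) = cong (c +_) (sum-map-const c xs)

count≡sum : (p : A → Bool) (xs : List A) → count p xs ≡ sum (map (fromBool ∘ p) xs)
count≡sum p [] = refl
count≡sum p (x ∷ xs) = trans (count-∷ p x xs) (cong (fromBool (p x) +_) (count≡sum p xs))

shift : (ℕ → ℕ) → ℕ → ℕ
shift f zero = 0
shift f (suc j) = f j

distribution-suc : (f : A → ℕ) (xs : List A) (j : ℕ) → distribution (suc ∘ f) xs j ≡ shift (distribution f xs) j
distribution-suc f xs zero = count-false xs
distribution-suc f xs (suc j) = refl

filterᵇ-map : (p : A → Bool) (f : B → A) (xs : List B) → filterᵇ p (map f xs) ≡ map f (filterᵇ (p ∘ f) xs)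
filterᵇ-map p f [] = refl
filterᵇ-map p f (x ∷ xs) with p (f x)
... | true = cong (f x ∷_) (filterᵇ-map p f xs)
... | false = filterᵇ-map p f xs

filterᵇ-concatMap : (p : A → Bool) (f : B → List A) (xs : List B) →
                    filterᵇ p (concatMap f xs) ≡ concatMap (filterᵇ p ∘ f) xs
filterᵇ-concatMap p f [] = refl
filterᵇ-concatMap p f (x ∷ xs) =
  trans (Listₚ.filter-++ (T? ∘ p) (f x) (concatMap f xs)) (cong (filterᵇ p (f x) ++_) (filterᵇ-concatMap p f xs))

filterᵇ-∧ : (p q : A → Bool) (xs : List A) → filterᵇ (λ x → p x ∧ q x) xs ≡ filterᵇ q (filterᵇ p xs)
filterᵇ-∧ p q [] = refl
filterᵇ-∧ p q (x ∷ xs) with p x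
... | false = filterᵇ-∧ p q xs
... | true with q x
...   | true = cong (x ∷_) (filterᵇ-∧ p q xs)
...   | false = filterᵇ-∧ p q xs

filterᵇ-cong : {p q : A → Bool} (xs : List A) → (∀ x → p x ≡ q x) → filterᵇ p xs ≡ filterᵇ q xs
filterᵇ-cong {p = p} {q} [] _ = refl
filterᵇ-cong {p = p} {q} (x ∷ xs) p≡q with p x | q x | p≡q x
... | true | .true | refl = cong (x ∷_) (filterᵇ-cong xs p≡q)
... | false | .false | refl = filterᵇ-cong xs p≡q

filterᵇ-false : (xs : List A) → filterᵇ (λ _ → false) xs ≡ []
filterᵇ-false [] = refl
filterᵇ-false (x ∷ xs) = filterᵇ-false xs

concatMap-filterᵇ : (p : A → Bool) (f : A → List B) (xs : List A) →
                    concatMap (λ x → if p x then f x else []) xs ≡ concatMap f (filterᵇ p xs)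
concatMap-filterᵇ p f [] = refl
concatMap-filterᵇ p f (x ∷ xs) with p x
... | true = cong (f x ++_) (concatMap-filterᵇ p f xs)
... | false = concatMap-filterᵇ p f xs

concatMap≡cartesianProductWith : {C : Set} (f : A → B → C) (xs : List A) (ys : List B) →
                                 concatMap (λ x → map (f x) ys) xs ≡ List.cartesianProductWith f xs ys
concatMap≡cartesianProductWith f [] ys = refl
concatMap≡cartesianProductWith f (x ∷ xs) ys = cong (map (f x) ys ++_) (concatMap≡cartesianProductWith f xs ys)

∈-concatMap-witness : (f : B → List A) {x : B} {xs : List B} {y : A} → x ∈ xs → y ∈ f x → y ∈ concatMap f xs
∈-concatMap-witness f x∈ y∈ = ∈ₚ.∈-concatMap⁺ f (Any.map (λ { refl → y∈ }) x∈)

allᵇ⁻ : (p : A → Bool) (xs : List A) → T (allᵇ p xs) → All (T ∘ p) xs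
allᵇ⁻ p [] _ = []
allᵇ⁻ p (x ∷ xs) t = proj₁ (Equivalence.to T-∧ t) ∷ allᵇ⁻ p xs (proj₂ (Equivalence.to T-∧ t))

allᵇ⁺ : (p : A → Bool) {xs : List A} → All (T ∘ p) xs → T (allᵇ p xs)
allᵇ⁺ p [] = _
allᵇ⁺ p (px ∷ pxs) = Equivalence.from T-∧ (px , allᵇ⁺ p pxs)

allᵇ-map : (p : A → Bool) (f : B → A) (xs : List B) → allᵇ p (map f xs) ≡ allᵇ (p ∘ f) xs
allᵇ-map p f [] = refl
allᵇ-map p f (x ∷ xs) = cong (p (f x) ∧_) (allᵇ-map p f xs)

allᵇ-cong : {p q : A → Bool} (xs : List A) → (∀ x → p x ≡ q x) → allᵇ p xs ≡ allᵇ q xs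
allᵇ-cong [] _ = refl
allᵇ-cong (x ∷ xs) p≡q = cong₂ _∧_ (p≡q x) (allᵇ-cong xs p≡q)

T-ext : {a b : Bool} → (T a → T b) → (T b → T a) → a ≡ b
T-ext {false} {false} _ _ = refl
T-ext {false} {true} _ b⇒a = ⊥-elim (b⇒a _)
T-ext {true} {false} a⇒b _ = ⊥-elim (a⇒b _)
T-ext {true} {true} _ _ = refl

finList : (N : ℕ) → List (Fin N)
finList N = Vec.toList (Vec.allFin N)

finList-suc : (N : ℕ) → finList (suc N) ≡ zero ∷ map suc (finList N)
finList-suc N = trans (cong Vec.toList (Vecₚ.allFin-map N)) (cong (zero ∷_) (Vecₚ.toList-map suc (Vec.allFin N)))

length-finList : (N : ℕ) → length (finList N) ≡ N
length-finList zero = refl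
length-finList (suc N) = begin
  length (finList (suc N))          ≡⟨ cong length (finList-suc N) ⟩
  suc (length (map suc (finList N))) ≡⟨ cong suc (Listₚ.length-map suc (finList N)) ⟩
  suc (length (finList N))          ≡⟨ cong suc (length-finList N) ⟩
  suc N                             ∎
  where open ≡-Reasoning

∈-finList : {N : ℕ} (i : Fin N) → i ∈ finList N
∈-finList {suc N} zero rewrite finList-suc N = here refl
∈-finList {suc N} (suc i) rewrite finList-suc N = there (∈ₚ.∈-map⁺ suc (∈-finList i))

finList-unique : (N : ℕ) → Unique (finList N)
finList-unique zero = []
finList-unique (suc N) rewrite finList-suc N =
  Allₚ.map⁺ (All.universal (λ _ ()) (finList N)) ∷ Uniqueₚ.map⁺ Finₚ.suc-injective (finList-unique N)

count-finList-suc : {N : ℕ} (p : Fin (suc N) → Bool) →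
                    count p (finList (suc N)) ≡ fromBool (p zero) + count (p ∘ suc) (finList N)
count-finList-suc {N} p = begin
  count p (finList (suc N))                           ≡⟨ cong (count p) (finList-suc N) ⟩
  count p (zero ∷ map suc (finList N))                ≡⟨ count-∷ p zero (map suc (finList N)) ⟩
  fromBool (p zero) + count p (map suc (finList N))   ≡⟨ cong (fromBool (p zero) +_) (count-map p suc (finList N)) ⟩
  fromBool (p zero) + count (p ∘ suc) (finList N)     ∎
  where open ≡-Reasoning

count-finList-punchIn : {N : ℕ} (x : Fin (suc N)) (p : Fin (suc N) → Bool) →
                        fromBool (p x) + count (p ∘ punchIn x) (finList N) ≡ count p (finList (suc N))
count-finList-punchIn zero p = sym (count-finList-suc p)
count-finList-punchIn {suc N} (suc u) p = begin
  fromBool (p (suc u)) + count (p ∘ punchIn (suc u)) (finList (suc N))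
    ≡⟨ cong (fromBool (p (suc u)) +_) (count-finList-suc (p ∘ punchIn (suc u))) ⟩
  fromBool (p (suc u)) + (fromBool (p zero) + count (p ∘ suc ∘ punchIn u) (finList N))
    ≡⟨ x∙yz≈y∙xz (fromBool (p (suc u))) (fromBool (p zero)) _ ⟩
  fromBool (p zero) + (fromBool (p (suc u)) + count (p ∘ suc ∘ punchIn u) (finList N))
    ≡⟨ cong (fromBool (p zero) +_) (count-finList-punchIn u (p ∘ suc)) ⟩
  fromBool (p zero) + count (p ∘ suc) (finList (suc N))
    ≡⟨ count-finList-suc p ⟨
  count p (finList (suc (suc N)))
    ∎
  where
  open ≡-Reasoning
  open import Algebra.Properties.CommutativeSemigroup +-commutativeSemigroup using (x∙yz≈y∙xz)

sum-finList-<ᵇ : (M R : ℕ) → R ≤ M → (G : Bool → ℕ) →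
                 sum (map (λ x → G (toℕ x <ᵇ R)) (finList M)) ≡ R * G true + (M ∸ R) * G false
sum-finList-<ᵇ M zero _ G = begin
  sum (map (λ x → G (toℕ x <ᵇ 0)) (finList M))
    ≡⟨ cong sum (Listₚ.map-cong (λ x → cong G (n<ᵇ0 (toℕ x))) (finList M)) ⟩
  sum (map (λ _ → G false) (finList M))
    ≡⟨ sum-map-const (G false) (finList M) ⟩
  length (finList M) * G false
    ≡⟨ cong (_* G false) (length-finList M) ⟩
  M * G false
    ∎
  where
  open ≡-Reasoning
  n<ᵇ0 : ∀ n → (n <ᵇ 0) ≡ false
  n<ᵇ0 zero = refl
  n<ᵇ0 (suc n) = refl
sum-finList-<ᵇ (suc M) (suc R) (s≤s R≤M) G = begin
  sum (map (λ x → G (toℕ x <ᵇ suc R)) (finList (suc M)))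
    ≡⟨ cong (sum ∘ map (λ x → G (toℕ x <ᵇ suc R))) (finList-suc M) ⟩
  G true + sum (map (λ x → G (toℕ x <ᵇ suc R)) (map suc (finList M)))
    ≡⟨ cong (λ xs → G true + sum xs) (sym (Listₚ.map-∘ (finList M))) ⟩
  G true + sum (map (λ x → G (toℕ x <ᵇ R)) (finList M))
    ≡⟨ cong (G true +_) (sum-finList-<ᵇ M R R≤M G) ⟩
  G true + (R * G true + (M ∸ R) * G false)
    ≡⟨ +-assoc (G true) _ _ ⟨
  suc R * G true + (suc M ∸ suc R) * G false
    ∎
  where open ≡-Reasoning

count-finList-<ᵇ : (N a : ℕ) → a ≤ N → count (λ y → toℕ y <ᵇ a) (finList N) ≡ a
count-finList-<ᵇ N a a≤N = begin
  count (λ y → toℕ y <ᵇ a) (finList N)                  ≡⟨ count≡sum (λ y → toℕ y <ᵇ a) (finList N) ⟩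
  sum (map (λ y → fromBool (toℕ y <ᵇ a)) (finList N))   ≡⟨ sum-finList-<ᵇ N a a≤N fromBool ⟩
  a * 1 + (N ∸ a) * 0                                   ≡⟨ cong₂ _+_ (*-identityʳ a) (*-zeroʳ (N ∸ a)) ⟩
  a + 0                                                 ≡⟨ +-identityʳ a ⟩
  a                                                     ∎
  where open ≡-Reasoning

-- Chosen so that distinct (x ∷ xs) unfolds to allᵇ (x ≢ᵇ_) xs ∧ distinct xs.
_≢ᵇ_ : {N : ℕ} → Fin N → Fin N → Bool
x ≢ᵇ y = not (does (x Finₚ.≟ y))

≢ᵇ-injective : {M N : ℕ} (f : Fin M → Fin N) → Injective _≡_ _≡_ f →
               (a b : Fin M) → (f a ≢ᵇ f b) ≡ (a ≢ᵇ b)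
≢ᵇ-injective f f-inj a b with f a Finₚ.≟ f b | a Finₚ.≟ b
... | yes _ | yes _ = refl
... | no _ | no _ = refl
... | yes fa≡fb | no a≢b = ⊥-elim (a≢b (f-inj fa≡fb))
... | no fa≢fb | yes refl = ⊥-elim (fa≢fb refl)

distinct-map : {M N : ℕ} (f : Fin M → Fin N) → Injective _≡_ _≡_ f → (xs : List (Fin M)) →
               distinct (map f xs) ≡ distinct xs
distinct-map f f-inj [] = refl
distinct-map f f-inj (x ∷ xs) = cong₂ _∧_
  (trans (allᵇ-map (f x ≢ᵇ_) f xs) (allᵇ-cong xs (≢ᵇ-injective f f-inj x)))
  (distinct-map f f-inj xs)

distinct-toList-map : {M N k : ℕ} (f : Fin M → Fin N) → Injective _≡_ _≡_ f → (v : Vec (Fin M) k) →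
                      distinct (Vec.toList (Vec.map f v)) ≡ distinct (Vec.toList v)
distinct-toList-map f f-inj v = trans (cong distinct (Vecₚ.toList-map f v)) (distinct-map f f-inj (Vec.toList v))

≢ᵇ⇒≢ : {N : ℕ} {x y : Fin N} → T (x ≢ᵇ y) → x ≢ y
≢ᵇ⇒≢ {x = x} {y} t with x Finₚ.≟ y
... | no x≢y = x≢y

≢⇒≢ᵇ : {N : ℕ} {x y : Fin N} → x ≢ y → T (x ≢ᵇ y)
≢⇒≢ᵇ {x = x} {y} x≢y with x Finₚ.≟ y
... | yes x≡y = x≢y x≡y
... | no _ = _

avoids : {N k : ℕ} → Fin N → Vec (Fin N) k → Bool
avoids x v = allᵇ (x ≢ᵇ_) (Vec.toList v)

avoids⇒≢ : {N k : ℕ} {x : Fin N} (w : Vec (Fin N) k) → T (avoids x w) → ∀ j → x ≢ lookup w j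
avoids⇒≢ w t j = ≢ᵇ⇒≢ (All.lookup (allᵇ⁻ _ (Vec.toList w) t) (∈-toList⁺ (∈-lookup j w)))

≢⇒avoids : {N k : ℕ} {x : Fin N} (w : Vec (Fin N) k) → (∀ j → x ≢ lookup w j) → T (avoids x w)
≢⇒avoids {x = x} w x≢w = allᵇ⁺ (x ≢ᵇ_) (VAllₚ.toList⁺ {xs = w} (VAllₚ.lookup⁻ (≢⇒≢ᵇ ∘ x≢w)))

distinct⇒injective : {N k : ℕ} (v : Vec (Fin N) k) → T (distinct (Vec.toList v)) → Injective _≡_ _≡_ (lookup v)
distinct⇒injective (x ∷ w) d {zero} {zero} _ = refl
distinct⇒injective (x ∷ w) d {zero} {suc j} x≡wj = ⊥-elim (avoids⇒≢ w (proj₁ (Equivalence.to T-∧ d)) j x≡wj)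
distinct⇒injective (x ∷ w) d {suc i} {zero} wi≡x = ⊥-elim (avoids⇒≢ w (proj₁ (Equivalence.to T-∧ d)) i (sym wi≡x))
distinct⇒injective (x ∷ w) d {suc i} {suc j} wi≡wj = cong suc (distinct⇒injective w (proj₂ (Equivalence.to T-∧ d)) wi≡wj)

injective⇒distinct : {N k : ℕ} (v : Vec (Fin N) k) → Injective _≡_ _≡_ (lookup v) → T (distinct (Vec.toList v))
injective⇒distinct [] _ = _
injective⇒distinct (x ∷ w) v-inj = Equivalence.from T-∧
  ( ≢⇒avoids w (λ j x≡wj → Finₚ.0≢1+n (v-inj {zero} {suc j} x≡wj))
  , injective⇒distinct w (Finₚ.suc-injective ∘ v-inj) )

-- Decomposition of S_{N+1} by the first entry

filterᵇ-≢-finList : (N : ℕ) (x : Fin (suc N)) →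
                    filterᵇ (x ≢ᵇ_) (finList (suc N)) ≡ map (punchIn x) (finList N)
filterᵇ-≢-finList N zero = begin
  filterᵇ (zero ≢ᵇ_) (finList (suc N))        ≡⟨ cong (filterᵇ (zero ≢ᵇ_)) (finList-suc N) ⟩
  filterᵇ (zero ≢ᵇ_) (map suc (finList N))    ≡⟨ filterᵇ-map (zero ≢ᵇ_) suc (finList N) ⟩
  map suc (filterᵇ (λ _ → true) (finList N))  ≡⟨ cong (map suc) (Listₚ.filter-all (λ _ → T? true) (All.universal _ _)) ⟩
  map suc (finList N)                         ∎
  where open ≡-Reasoning
filterᵇ-≢-finList (suc N) (suc u) = begin
  filterᵇ (suc u ≢ᵇ_) (finList (suc (suc N)))
    ≡⟨ cong (filterᵇ (suc u ≢ᵇ_)) (finList-suc (suc N)) ⟩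
  zero ∷ filterᵇ (suc u ≢ᵇ_) (map suc (finList (suc N)))
    ≡⟨ cong (zero ∷_) (filterᵇ-map (suc u ≢ᵇ_) suc (finList (suc N))) ⟩
  zero ∷ map suc (filterᵇ (u ≢ᵇ_) (finList (suc N)))
    ≡⟨ cong (λ xs → zero ∷ map suc xs) (filterᵇ-≢-finList N u) ⟩
  zero ∷ map suc (map (punchIn u) (finList N))
    ≡⟨ cong (zero ∷_) (sym (Listₚ.map-∘ (finList N))) ⟩
  zero ∷ map (punchIn (suc u) ∘ suc) (finList N)
    ≡⟨ cong (zero ∷_) (Listₚ.map-∘ (finList N)) ⟩
  map (punchIn (suc u)) (zero ∷ map suc (finList N))
    ≡⟨ cong (map (punchIn (suc u))) (finList-suc N) ⟨
  map (punchIn (suc u)) (finList (suc N))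
    ∎
  where open ≡-Reasoning

filterᵇ-avoids-allVecs : (N k : ℕ) (x : Fin (suc N)) →
                         filterᵇ (avoids x) (allVecs (suc N) k) ≡ map (Vec.map (punchIn x)) (allVecs N k)
filterᵇ-avoids-allVecs N zero x = refl
filterᵇ-avoids-allVecs N (suc k) x = begin
  filterᵇ (avoids x) (concatMap (λ y → map (y ∷_) vs) (finList (suc N)))
    ≡⟨ filterᵇ-concatMap (avoids x) (λ y → map (y ∷_) vs) (finList (suc N)) ⟩
  concatMap (λ y → filterᵇ (avoids x) (map (y ∷_) vs)) (finList (suc N))
    ≡⟨ Listₚ.concatMap-cong filter-cons (finList (suc N)) ⟩
  concatMap (λ y → if x ≢ᵇ y then map (y ∷_) (filterᵇ (avoids x) vs) else []) (finList (suc N))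
    ≡⟨ concatMap-filterᵇ (x ≢ᵇ_) (λ y → map (y ∷_) (filterᵇ (avoids x) vs)) (finList (suc N)) ⟩
  concatMap (λ y → map (y ∷_) (filterᵇ (avoids x) vs)) (filterᵇ (x ≢ᵇ_) (finList (suc N)))
    ≡⟨ cong₂ (λ us ys → concatMap (λ y → map (y ∷_) us) ys)
             (filterᵇ-avoids-allVecs N k x) (filterᵇ-≢-finList N x) ⟩
  concatMap (λ y → map (y ∷_) (map (Vec.map (punchIn x)) ws)) (map (punchIn x) (finList N))
    ≡⟨ Listₚ.concatMap-map _ (punchIn x) (finList N) ⟩
  concatMap (λ z → map (punchIn x z ∷_) (map (Vec.map (punchIn x)) ws)) (finList N)
    ≡⟨ Listₚ.concatMap-cong (λ z → trans (sym (Listₚ.map-∘ ws)) (Listₚ.map-∘ ws)) (finList N) ⟩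
  concatMap (λ z → map (Vec.map (punchIn x)) (map (z ∷_) ws)) (finList N)
    ≡⟨ Listₚ.map-concatMap (Vec.map (punchIn x)) (λ z → map (z ∷_) ws) (finList N) ⟨
  map (Vec.map (punchIn x)) (allVecs N (suc k))
    ∎
  where
  open ≡-Reasoning
  vs = allVecs (suc N) k
  ws = allVecs N k
  filter-cons : ∀ y → filterᵇ (avoids x) (map (y ∷_) vs) ≡ (if x ≢ᵇ y then map (y ∷_) (filterᵇ (avoids x) vs) else [])
  filter-cons y with x ≢ᵇ y in x≢ᵇy
  ... | true = trans (filterᵇ-map (avoids x) (y ∷_) vs)
                     (cong (map (y ∷_)) (filterᵇ-cong vs (λ v → cong (_∧ avoids x v) x≢ᵇy)))
  ... | false = trans (filterᵇ-map (avoids x) (y ∷_) vs)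
                      (cong (map (y ∷_)) (trans (filterᵇ-cong vs (λ v → cong (_∧ avoids x v) x≢ᵇy))
                                                (filterᵇ-false vs)))

_◃_ : {N : ℕ} → Fin (suc N) → Vec (Fin N) N → Vec (Fin (suc N)) (suc N)
x ◃ σ = x ∷ Vec.map (punchIn x) σ

SymGroup-suc : (N : ℕ) → SymGroup (suc N) ≡ concatMap (λ x → map (x ◃_) (SymGroup N)) (finList (suc N))
SymGroup-suc N = begin
  filterᵇ isPerm (concatMap (λ x → map (x ∷_) vs) (finList (suc N)))
    ≡⟨ filterᵇ-concatMap isPerm (λ x → map (x ∷_) vs) (finList (suc N)) ⟩
  concatMap (λ x → filterᵇ isPerm (map (x ∷_) vs)) (finList (suc N))
    ≡⟨ Listₚ.concatMap-cong first-entry (finList (suc N)) ⟩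
  concatMap (λ x → map (x ◃_) (SymGroup N)) (finList (suc N))
    ∎
  where
  open ≡-Reasoning
  vs = allVecs (suc N) N
  ws = allVecs N N
  distinctEntries : {M : ℕ} → Vec (Fin M) N → Bool
  distinctEntries v = distinct (Vec.toList v)
  first-entry : ∀ x → filterᵇ isPerm (map (x ∷_) vs) ≡ map (x ◃_) (SymGroup N)
  first-entry x = begin
    filterᵇ isPerm (map (x ∷_) vs)
      ≡⟨ filterᵇ-map isPerm (x ∷_) vs ⟩
    map (x ∷_) (filterᵇ (λ v → avoids x v ∧ distinctEntries v) vs)
      ≡⟨ cong (map (x ∷_)) (filterᵇ-∧ (avoids x) distinctEntries vs) ⟩
    map (x ∷_) (filterᵇ distinctEntries (filterᵇ (avoids x) vs))
      ≡⟨ cong (map (x ∷_) ∘ filterᵇ distinctEntries) (filterᵇ-avoids-allVecs N N x) ⟩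
    map (x ∷_) (filterᵇ distinctEntries (map (Vec.map (punchIn x)) ws))
      ≡⟨ cong (map (x ∷_)) (filterᵇ-map distinctEntries (Vec.map (punchIn x)) ws) ⟩
    map (x ∷_) (map (Vec.map (punchIn x)) (filterᵇ (distinctEntries ∘ Vec.map (punchIn x)) ws))
      ≡⟨ cong (map (x ∷_) ∘ map (Vec.map (punchIn x)))
              (filterᵇ-cong ws (distinct-toList-map (punchIn x) (Finₚ.punchIn-injective x _ _))) ⟩
    map (x ∷_) (map (Vec.map (punchIn x)) (SymGroup N))
      ≡⟨ Listₚ.map-∘ (SymGroup N) ⟨
    map (x ◃_) (SymGroup N)
      ∎

allVecs-unique : (N k : ℕ) → Unique (allVecs N k)
allVecs-unique N zero = [] ∷ []
allVecs-unique N (suc k) = subst Unique (sym (concatMap≡cartesianProductWith _∷_ (finList N) (allVecs N k)))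
  (Uniqueₚ.cartesianProductWith⁺ _∷_ Vecₚ.∷-injective (finList-unique N) (allVecs-unique N k))

∈-allVecs : {N k : ℕ} (v : Vec (Fin N) k) → v ∈ allVecs N k
∈-allVecs [] = here refl
∈-allVecs {N} (x ∷ w) =
  ∈-concatMap-witness (λ y → map (y ∷_) (allVecs N _)) (∈-finList x) (∈ₚ.∈-map⁺ (x ∷_) (∈-allVecs w))

SymGroup-unique : (N : ℕ) → Unique (SymGroup N)
SymGroup-unique N = Uniqueₚ.filter⁺ (T? ∘ isPerm) (allVecs-unique N N)

∈-SymGroup⁻ : {N : ℕ} {π : Vec (Fin N) N} → π ∈ SymGroup N → T (isPerm π)
∈-SymGroup⁻ {N} π∈ = proj₂ (∈ₚ.∈-filter⁻ (T? ∘ isPerm) {xs = allVecs N N} π∈)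

∈-SymGroup⁺ : {N : ℕ} {π : Vec (Fin N) N} → T (isPerm π) → π ∈ SymGroup N
∈-SymGroup⁺ {π = π} isPerm-π = ∈ₚ.∈-filter⁺ (T? ∘ isPerm) (∈-allVecs π) isPerm-π

∈-SymGroup⇒injective : {N : ℕ} {π : Vec (Fin N) N} → π ∈ SymGroup N → Injective _≡_ _≡_ (lookup π)
∈-SymGroup⇒injective {π = π} π∈ = distinct⇒injective π (∈-SymGroup⁻ π∈)

map-∈-SymGroup : {N : ℕ} {f : Fin N → Fin N} → Injective _≡_ _≡_ f → {σ : Vec (Fin N) N} →
                 σ ∈ SymGroup N → Vec.map f σ ∈ SymGroup N
map-∈-SymGroup {f = f} f-inj {σ} σ∈ =
  ∈-SymGroup⁺ (subst T (sym (distinct-toList-map f f-inj σ)) (∈-SymGroup⁻ σ∈))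

map-inverse : {M N k : ℕ} {f : Fin M → Fin N} {g : Fin N → Fin M} → (∀ y → g (f y) ≡ y) →
              (v : Vec (Fin M) k) → Vec.map g (Vec.map f v) ≡ v
map-inverse g∘f≗id v = trans (sym (Vecₚ.map-∘ _ _ v)) (trans (Vecₚ.map-cong g∘f≗id v) (Vecₚ.map-id v))

∈-SymGroup-suc⁻ : {N : ℕ} {π : Vec (Fin (suc N)) (suc N)} → π ∈ SymGroup (suc N) →
                  ∃ λ x → ∃ λ σ → σ ∈ SymGroup N × π ≡ x ◃ σ
∈-SymGroup-suc⁻ {N} π∈
  with x , π∈map ← Any.satisfied (∈ₚ.∈-concatMap⁻ (λ x → map (x ◃_) (SymGroup N)) {xs = finList (suc N)}
                                                 (subst (_ ∈_) (SymGroup-suc N) π∈))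
  with σ , σ∈ , π≡x◃σ ← ∈ₚ.∈-map⁻ (x ◃_) π∈map = x , σ , σ∈ , π≡x◃σ

◃-∈-SymGroup : {N : ℕ} (x : Fin (suc N)) {σ : Vec (Fin N) N} → σ ∈ SymGroup N → x ◃ σ ∈ SymGroup (suc N)
◃-∈-SymGroup {N} x {σ} σ∈ = subst (x ◃ σ ∈_) (sym (SymGroup-suc N))
  (∈-concatMap-witness (λ y → map (y ◃_) (SymGroup N)) (∈-finList x) (∈ₚ.∈-map⁺ (x ◃_) σ∈))

count-SymGroup-suc : {N : ℕ} (p : Vec (Fin (suc N)) (suc N) → Bool) →
  count p (SymGroup (suc N)) ≡ sum (map (λ x → count (p ∘ (x ◃_)) (SymGroup N)) (finList (suc N)))
count-SymGroup-suc {N} p = begin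
  count p (SymGroup (suc N))
    ≡⟨ cong (count p) (SymGroup-suc N) ⟩
  count p (concatMap (λ x → map (x ◃_) (SymGroup N)) (finList (suc N)))
    ≡⟨ count-concatMap p (λ x → map (x ◃_) (SymGroup N)) (finList (suc N)) ⟩
  sum (map (λ x → count p (map (x ◃_) (SymGroup N))) (finList (suc N)))
    ≡⟨ cong sum (Listₚ.map-cong (λ x → count-map p (x ◃_) (SymGroup N)) (finList (suc N))) ⟩
  sum (map (λ x → count (p ∘ (x ◃_)) (SymGroup N)) (finList (suc N)))
    ∎
  where open ≡-Reasoning

length-SymGroup : (N : ℕ) → length (SymGroup N) ≡ N !
length-SymGroup zero = refl
length-SymGroup (suc N) = begin
  length (SymGroup (suc N))
    ≡⟨ count-true (SymGroup (suc N)) ⟨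
  count (λ _ → true) (SymGroup (suc N))
    ≡⟨ count-SymGroup-suc {N} (λ _ → true) ⟩
  sum (map (λ _ → count (λ _ → true) (SymGroup N)) (finList (suc N)))
    ≡⟨ sum-map-const (count (λ _ → true) (SymGroup N)) (finList (suc N)) ⟩
  length (finList (suc N)) * count (λ _ → true) (SymGroup N)
    ≡⟨ cong₂ _*_ (length-finList (suc N)) (trans (count-true (SymGroup N)) (length-SymGroup N)) ⟩
  suc N !
    ∎
  where open ≡-Reasoning

count-toList-perm : {N : ℕ} {σ : Vec (Fin N) N} → σ ∈ SymGroup N → (p : Fin N → Bool) →
                    count p (Vec.toList σ) ≡ count p (finList N)
count-toList-perm {zero} {[]} _ p = refl
count-toList-perm {suc N} σ∈ p with ∈-SymGroup-suc⁻ σ∈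
... | x , τ , τ∈ , refl = begin
  count p (x ∷ Vec.toList (Vec.map (punchIn x) τ))
    ≡⟨ count-∷ p x _ ⟩
  fromBool (p x) + count p (Vec.toList (Vec.map (punchIn x) τ))
    ≡⟨ cong (λ xs → fromBool (p x) + count p xs) (Vecₚ.toList-map (punchIn x) τ) ⟩
  fromBool (p x) + count p (map (punchIn x) (Vec.toList τ))
    ≡⟨ cong (fromBool (p x) +_) (count-map p (punchIn x) (Vec.toList τ)) ⟩
  fromBool (p x) + count (p ∘ punchIn x) (Vec.toList τ)
    ≡⟨ cong (fromBool (p x) +_) (count-toList-perm τ∈ (p ∘ punchIn x)) ⟩
  fromBool (p x) + count (p ∘ punchIn x) (finList N)
    ≡⟨ count-finList-punchIn x p ⟩
  count p (finList (suc N))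
    ∎
  where open ≡-Reasoning

distribution-SymGroup-suc : {N : ℕ} (F : Vec (Fin (suc N)) (suc N) → ℕ) (b : Fin (suc N) → Bool)
  (G : Fin (suc N) → Vec (Fin N) N → ℕ) →
  (∀ x {σ} → σ ∈ SymGroup N → F (x ◃ σ) ≡ fromBool (b x) + G x σ) →
  (j : ℕ) → distribution F (SymGroup (suc N)) j ≡
            sum (map (λ x → distribution (λ σ → fromBool (b x) + G x σ) (SymGroup N) j) (finList (suc N)))
distribution-SymGroup-suc {N} F b G F-◃ j = trans (count-SymGroup-suc (λ π → F π ≡ᵇ j))
  (cong sum (Listₚ.map-cong (λ x → count-cong (SymGroup N) (cong (_≡ᵇ j) ∘ F-◃ x)) (finList (suc N))))

-- The statistic c_{m,n}

-- c m n is cStat m on S_{m+n}; the recursion lowers the cutoff and the length together.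
cStat : {N : ℕ} → ℕ → Vec (Fin N) N → ℕ
cStat r π = cAux r (map toℕ (Vec.toList π))

punchInℕ : ℕ → ℕ → ℕ
punchInℕ zero y = suc y
punchInℕ (suc c) zero = zero
punchInℕ (suc c) (suc y) = suc (punchInℕ c y)

toℕ-punchIn : {N : ℕ} (x : Fin (suc N)) (y : Fin N) → toℕ (punchIn x y) ≡ punchInℕ (toℕ x) (toℕ y)
toℕ-punchIn zero y = refl
toℕ-punchIn (suc x) zero = refl
toℕ-punchIn (suc x) (suc y) = cong suc (toℕ-punchIn x y)

punchInℕ-<ᵇ : (c a b : ℕ) → (punchInℕ c a <ᵇ punchInℕ c b) ≡ (a <ᵇ b)
punchInℕ-<ᵇ zero a b = refl
punchInℕ-<ᵇ (suc c) zero zero = refl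
punchInℕ-<ᵇ (suc c) zero (suc b) = refl
punchInℕ-<ᵇ (suc c) (suc a) zero = refl
punchInℕ-<ᵇ (suc c) (suc a) (suc b) = punchInℕ-<ᵇ c a b

punchInℕ-<ᵇ-pivot : (c y : ℕ) → (punchInℕ c y <ᵇ c) ≡ (y <ᵇ c)
punchInℕ-<ᵇ-pivot zero y = refl
punchInℕ-<ᵇ-pivot (suc c) zero = refl
punchInℕ-<ᵇ-pivot (suc c) (suc y) = punchInℕ-<ᵇ-pivot c y

countLess≡count : (a : ℕ) (ys : List ℕ) → countLess a ys ≡ count (_<ᵇ a) ys
countLess≡count a [] = refl
countLess≡count a (y ∷ ys) with y <ᵇ a
... | true = cong suc (countLess≡count a ys)
... | false = countLess≡count a ys

countLess-map : (a b : ℕ) (f : ℕ → ℕ) (ys : List ℕ) → (∀ y → (f y <ᵇ b) ≡ (y <ᵇ a)) →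
                countLess b (map f ys) ≡ countLess a ys
countLess-map a b f ys f-resp = begin
  countLess b (map f ys)         ≡⟨ countLess≡count b (map f ys) ⟩
  count (_<ᵇ b) (map f ys)       ≡⟨ count-map (_<ᵇ b) f ys ⟩
  count (λ y → f y <ᵇ b) ys      ≡⟨ count-cong ys (λ {y} _ → f-resp y) ⟩
  count (_<ᵇ a) ys               ≡⟨ countLess≡count a ys ⟨
  countLess a ys                 ∎
  where open ≡-Reasoning

cAux-map : (f : ℕ → ℕ) → (∀ a b → (f a <ᵇ f b) ≡ (a <ᵇ b)) → (r : ℕ) (ys : List ℕ) →
           cAux r (map f ys) ≡ cAux r ys
cAux-map f f-mono zero ys = refl
cAux-map f f-mono (suc r) [] = refl
cAux-map f f-mono (suc r) (y ∷ ys) =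
  cong₂ (λ k s → fromBool (k <ᵇ suc r) + s) (countLess-map y (f y) f ys (λ z → f-mono z y)) (cAux-map f f-mono r ys)

cStat-◃ : {N : ℕ} (r : ℕ) (x : Fin (suc N)) {σ : Vec (Fin N) N} → σ ∈ SymGroup N →
          cStat (suc r) (x ◃ σ) ≡ fromBool (toℕ x <ᵇ suc r) + cStat r σ
cStat-◃ {N} r x {σ} σ∈ = cong₂ (λ k s → fromBool (k <ᵇ suc r) + s) countLess-tail cAux-tail
  where
  open ≡-Reasoning
  tail = map toℕ (Vec.toList (Vec.map (punchIn x) σ))
  σℕ = map toℕ (Vec.toList σ)
  tail≡ : tail ≡ map (punchInℕ (toℕ x)) σℕ
  tail≡ = begin
    map toℕ (Vec.toList (Vec.map (punchIn x) σ)) ≡⟨ cong (map toℕ) (Vecₚ.toList-map (punchIn x) σ) ⟩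
    map toℕ (map (punchIn x) (Vec.toList σ))     ≡⟨ Listₚ.map-∘ (Vec.toList σ) ⟨
    map (toℕ ∘ punchIn x) (Vec.toList σ)         ≡⟨ Listₚ.map-cong (toℕ-punchIn x) (Vec.toList σ) ⟩
    map (punchInℕ (toℕ x) ∘ toℕ) (Vec.toList σ)  ≡⟨ Listₚ.map-∘ (Vec.toList σ) ⟩
    map (punchInℕ (toℕ x)) σℕ                    ∎
  cAux-tail : cAux r tail ≡ cStat r σ
  cAux-tail = trans (cong (cAux r) tail≡) (cAux-map (punchInℕ (toℕ x)) (punchInℕ-<ᵇ (toℕ x)) r σℕ)
  countLess-tail : countLess (toℕ x) tail ≡ toℕ x
  countLess-tail = begin
    countLess (toℕ x) tail                        ≡⟨ cong (countLess (toℕ x)) tail≡ ⟩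
    countLess (toℕ x) (map (punchInℕ (toℕ x)) σℕ) ≡⟨ countLess-map _ _ (punchInℕ (toℕ x)) σℕ (punchInℕ-<ᵇ-pivot (toℕ x)) ⟩
    countLess (toℕ x) σℕ                          ≡⟨ countLess≡count (toℕ x) σℕ ⟩
    count (_<ᵇ toℕ x) σℕ                          ≡⟨ count-map (_<ᵇ toℕ x) toℕ (Vec.toList σ) ⟩
    count (λ y → toℕ y <ᵇ toℕ x) (Vec.toList σ)   ≡⟨ count-toList-perm σ∈ (λ y → toℕ y <ᵇ toℕ x) ⟩
    count (λ y → toℕ y <ᵇ toℕ x) (finList N)      ≡⟨ count-finList-<ᵇ N (toℕ x) (Finₚ.toℕ≤pred[n] x) ⟩
    toℕ x                                         ∎

distribution-cStat-suc : (N r j : ℕ) → r ≤ N →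
  distribution (cStat (suc r)) (SymGroup (suc N)) j ≡
  suc r * shift (distribution (cStat r) (SymGroup N)) j + (N ∸ r) * distribution (cStat r) (SymGroup N) j
distribution-cStat-suc N r j r≤N = begin
  distribution (cStat (suc r)) (SymGroup (suc N)) j
    ≡⟨ distribution-SymGroup-suc {N} (cStat (suc r)) (λ x → toℕ x <ᵇ suc r) (λ _ → cStat r) (cStat-◃ r) j ⟩
  sum (map (λ x → G (toℕ x <ᵇ suc r)) (finList (suc N)))
    ≡⟨ sum-finList-<ᵇ (suc N) (suc r) (s≤s r≤N) G ⟩
  suc r * G true + (N ∸ r) * G false
    ≡⟨ cong (λ g → suc r * g + (N ∸ r) * G false) (distribution-suc (cStat r) (SymGroup N) j) ⟩
  suc r * shift (distribution (cStat r) (SymGroup N)) j + (N ∸ r) * distribution (cStat r) (SymGroup N) j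
    ∎
  where
  open ≡-Reasoning
  G : Bool → ℕ
  G b = distribution (λ σ → fromBool b + cStat r σ) (SymGroup N) j

module _ {N : ℕ} (π : Vec (Fin N) N) where

  iter-+ : (a b : ℕ) (i : Fin N) → iter π (a + b) i ≡ iter π a (iter π b i)
  iter-+ zero b i = refl
  iter-+ (suc a) b i = cong (lookup π) (iter-+ a b i)

  iter-*-fixed : {p : ℕ} {i : Fin N} → iter π p i ≡ i → (k : ℕ) → iter π (k * p) i ≡ i
  iter-*-fixed πᵖi≡i zero = refl
  iter-*-fixed {p} {i} πᵖi≡i (suc k) =
    trans (iter-+ p (k * p) i) (trans (cong (iter π p) (iter-*-fixed πᵖi≡i k)) πᵖi≡i)

  iter-% : {p : ℕ} .{{_ : NonZero p}} {i : Fin N} → iter π p i ≡ i → (t : ℕ) → iter π (t % p) i ≡ iter π t i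
  iter-% {p} {i} πᵖi≡i t = sym (begin
    iter π t i                              ≡⟨ cong (λ s → iter π s i) (m≡m%n+[m/n]*n t p) ⟩
    iter π (t % p + (t / p) * p) i          ≡⟨ iter-+ (t % p) ((t / p) * p) i ⟩
    iter π (t % p) (iter π ((t / p) * p) i) ≡⟨ cong (iter π (t % p)) (iter-*-fixed πᵖi≡i (t / p)) ⟩
    iter π (t % p) i                        ∎)
    where open ≡-Reasoning

  module _ (π-injective : Injective _≡_ _≡_ (lookup π)) where

    iter-injective : (a : ℕ) → Injective _≡_ _≡_ (iter π a)
    iter-injective zero eq = eq
    iter-injective (suc a) eq = iter-injective a (π-injective eq)

    iter-period : (i : Fin N) → ∃ λ p → 0 < p × p ≤ N × iter π p i ≡ i
    iter-period i with a , b , a<b , πᵃi≡πᵇi ← Finₚ.pigeonhole (n<1+n N) (λ k → iter π (toℕ k) i) =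
      p , m<n⇒0<n∸m a<b , p≤N , sym (iter-injective (toℕ a) πᵃi≡πᵃπᵖi)
      where
      open ≡-Reasoning
      p = toℕ b ∸ toℕ a
      p≤N : p ≤ N
      p≤N = ≤-trans (m∸n≤m (toℕ b) (toℕ a)) (≤-pred (Finₚ.toℕ<n b))
      πᵃi≡πᵃπᵖi : iter π (toℕ a) i ≡ iter π (toℕ a) (iter π p i)
      πᵃi≡πᵃπᵖi = begin
        iter π (toℕ a) i            ≡⟨ πᵃi≡πᵇi ⟩
        iter π (toℕ b) i            ≡⟨ cong (λ s → iter π s i) (m+[n∸m]≡n (<⇒≤ a<b)) ⟨
        iter π (toℕ a + p) i        ≡⟨ iter-+ (toℕ a) p i ⟩
        iter π (toℕ a) (iter π p i) ∎

    orbit-within-N : (i : Fin N) (t : ℕ) → ∃ λ s → s < N × iter π t i ≡ iter π s i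
    orbit-within-N i t with p , 0<p , p≤N , πᵖi≡i ← iter-period i =
      t % p , <-≤-trans (m%n<n t p) p≤N , sym (iter-% πᵖi≡i t)
      where instance
      p-nonZero : NonZero p
      p-nonZero = >-nonZero 0<p

    orbit-closure : (Q : Fin N → Set) (i : Fin N) → Q i →
                    (∀ t → t < N → Q (iter π (suc t) i)) → ∀ t → Q (iter π t i)
    orbit-closure Q i Qi Q-first t with orbit-within-N i t
    ... | zero , _ , πᵗi≡i = subst Q (sym πᵗi≡i) Qi
    ... | suc s , s<N , πᵗi≡πˢi = subst Q (sym πᵗi≡πˢi) (Q-first s (<-trans (n<1+n s) s<N))

    orbit-allᵇ⇒ : (q : Fin N → Bool) (i : Fin N) → T (q i) →
                  T (allᵇ (λ t → q (iter π (suc t) i)) (upTo N)) → ∀ t → T (q (iter π t i))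
    orbit-allᵇ⇒ q i qi all-q = orbit-closure (T ∘ q) i qi
      (λ t t<N → Allₚ.applyUpTo⁻ (λ s → s) N (allᵇ⁻ _ (upTo N) all-q) t<N)

  orbit-allᵇ⇐ : (q : Fin N → Bool) (i : Fin N) → (∀ t → T (q (iter π t i))) →
                T (allᵇ (λ t → q (iter π (suc t) i)) (upTo N))
  orbit-allᵇ⇐ q i q-orbit = allᵇ⁺ _ (Allₚ.applyUpTo⁺₁ (λ s → s) N (λ {t} _ → q-orbit (suc t)))

-- Cycle minima and maxima

CycleMin CycleMax : {N : ℕ} → Vec (Fin N) N → Fin N → Set
CycleMin π i = ∀ t → toℕ i ≤ toℕ (iter π t i)
CycleMax π i = ∀ t → toℕ (iter π t i) ≤ toℕ i

isCycleMax : {N : ℕ} → Vec (Fin N) N → Fin N → Bool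
isCycleMax {N} π i = allᵇ (λ t → toℕ (iter π (suc t) i) ≤ᵇ toℕ i) (upTo N)

module _ {N : ℕ} (π : Vec (Fin N) N) where

  isCycleMin⇒ : Injective _≡_ _≡_ (lookup π) → {i : Fin N} → T (isCycleMin π i) → CycleMin π i
  isCycleMin⇒ π-inj {i} t = ≤ᵇ⇒≤ _ _ ∘ orbit-allᵇ⇒ π π-inj (λ y → toℕ i ≤ᵇ toℕ y) i (≤⇒≤ᵇ (≤-refl {toℕ i})) t

  isCycleMin⇐ : {i : Fin N} → CycleMin π i → T (isCycleMin π i)
  isCycleMin⇐ {i} min = orbit-allᵇ⇐ π (λ y → toℕ i ≤ᵇ toℕ y) i (≤⇒≤ᵇ ∘ min)

  isCycleMax⇒ : Injective _≡_ _≡_ (lookup π) → {i : Fin N} → T (isCycleMax π i) → CycleMax π i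
  isCycleMax⇒ π-inj {i} t = ≤ᵇ⇒≤ _ _ ∘ orbit-allᵇ⇒ π π-inj (λ y → toℕ y ≤ᵇ toℕ i) i (≤⇒≤ᵇ (≤-refl {toℕ i})) t

  isCycleMax⇐ : {i : Fin N} → CycleMax π i → T (isCycleMax π i)
  isCycleMax⇐ {i} max = orbit-allᵇ⇐ π (λ y → toℕ y ≤ᵇ toℕ i) i (≤⇒≤ᵇ ∘ max)

opposite-≤ : {N : ℕ} {a b : Fin N} → toℕ a ≤ toℕ b → toℕ (opposite b) ≤ toℕ (opposite a)
opposite-≤ {N} {a} {b} a≤b =
  subst₂ _≤_ (sym (Finₚ.opposite-prop b)) (sym (Finₚ.opposite-prop a)) (∸-monoʳ-≤ N (s≤s a≤b))

opposite-≤⁻ : {N : ℕ} {a b : Fin N} → toℕ (opposite b) ≤ toℕ (opposite a) → toℕ a ≤ toℕ b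
opposite-≤⁻ {a = a} {b} ob≤oa =
  subst₂ (λ x y → toℕ x ≤ toℕ y) (Finₚ.opposite-involutive a) (Finₚ.opposite-involutive b) (opposite-≤ ob≤oa)

opposite-injective : {N : ℕ} → Injective _≡_ _≡_ (opposite {N})
opposite-injective {x = a} {b} eq =
  trans (sym (Finₚ.opposite-involutive a)) (trans (cong opposite eq) (Finₚ.opposite-involutive b))

reflect : {N : ℕ} → Vec (Fin N) N → Vec (Fin N) N
reflect π = Vec.tabulate (opposite ∘ lookup π ∘ opposite)

module _ {N : ℕ} (π : Vec (Fin N) N) where

  lookup-reflect : (i : Fin N) → lookup (reflect π) i ≡ opposite (lookup π (opposite i))
  lookup-reflect = Vecₚ.lookup∘tabulate _

  reflect-involutive : reflect (reflect π) ≡ π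
  reflect-involutive = trans (Vecₚ.tabulate-cong (λ i → begin
      opposite (lookup (reflect π) (opposite i))             ≡⟨ cong opposite (lookup-reflect (opposite i)) ⟩
      opposite (opposite (lookup π (opposite (opposite i)))) ≡⟨ Finₚ.opposite-involutive _ ⟩
      lookup π (opposite (opposite i))                       ≡⟨ cong (lookup π) (Finₚ.opposite-involutive i) ⟩
      lookup π i                                             ∎))
    (Vecₚ.tabulate∘lookup π)
    where open ≡-Reasoning

  reflect-injective : Injective _≡_ _≡_ (lookup π) → Injective _≡_ _≡_ (lookup (reflect π))
  reflect-injective π-inj {i} {j} eq = opposite-injective (π-inj (opposite-injective (begin
      opposite (lookup π (opposite i)) ≡⟨ lookup-reflect i ⟨
      lookup (reflect π) i             ≡⟨ eq ⟩
      lookup (reflect π) j             ≡⟨ lookup-reflect j ⟩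
      opposite (lookup π (opposite j)) ∎)))
    where open ≡-Reasoning

  iter-reflect : (t : ℕ) (i : Fin N) → iter (reflect π) t i ≡ opposite (iter π t (opposite i))
  iter-reflect zero i = sym (Finₚ.opposite-involutive i)
  iter-reflect (suc t) i = begin
    lookup (reflect π) (iter (reflect π) t i)
      ≡⟨ cong (lookup (reflect π)) (iter-reflect t i) ⟩
    lookup (reflect π) (opposite (iter π t (opposite i)))
      ≡⟨ lookup-reflect _ ⟩
    opposite (lookup π (opposite (opposite (iter π t (opposite i)))))
      ≡⟨ cong (opposite ∘ lookup π) (Finₚ.opposite-involutive _) ⟩
    opposite (iter π (suc t) (opposite i))
      ∎
    where open ≡-Reasoning

  CycleMin⇒CycleMax-reflect : {i : Fin N} → CycleMin π (opposite i) → CycleMax (reflect π) i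
  CycleMin⇒CycleMax-reflect {i} min t = subst₂ (λ x y → toℕ x ≤ toℕ y)
    (sym (iter-reflect t i)) (Finₚ.opposite-involutive i) (opposite-≤ (min t))

  CycleMax-reflect⇒CycleMin : {i : Fin N} → CycleMax (reflect π) i → CycleMin π (opposite i)
  CycleMax-reflect⇒CycleMin {i} max t = opposite-≤⁻ (subst₂ (λ x y → toℕ x ≤ toℕ y)
    (iter-reflect t i) (sym (Finₚ.opposite-involutive i)) (max t))

isPerm-reflect : {N : ℕ} (π : Vec (Fin N) N) → T (isPerm π) → T (isPerm (reflect π))
isPerm-reflect π isPerm-π = injective⇒distinct (reflect π) (reflect-injective π (distinct⇒injective π isPerm-π))

reflect-∈-SymGroup : {N : ℕ} {π : Vec (Fin N) N} → π ∈ SymGroup N → reflect π ∈ SymGroup N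
reflect-∈-SymGroup {π = π} π∈ = ∈-SymGroup⁺ (isPerm-reflect π (∈-SymGroup⁻ π∈))

cycleMaxima : {N : ℕ} → Vec (Fin N) N → ℕ
cycleMaxima {N} π = count (isCycleMax π) (finList N)

isCycleMin-opposite : {N : ℕ} (π : Vec (Fin N) N) → T (isPerm π) → (i : Fin N) →
                      isCycleMin π (opposite i) ≡ isCycleMax (reflect π) i
isCycleMin-opposite π isPerm-π i = T-ext
  (isCycleMax⇐ (reflect π) ∘ CycleMin⇒CycleMax-reflect π ∘ isCycleMin⇒ π (distinct⇒injective π isPerm-π))
  (isCycleMin⇐ π ∘ CycleMax-reflect⇒CycleMin π ∘ isCycleMax⇒ (reflect π) reflect-π-injective)
  where reflect-π-injective = distinct⇒injective (reflect π) (isPerm-reflect π isPerm-π)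

cycles≡cycleMaxima-reflect : {N : ℕ} (π : Vec (Fin N) N) → T (isPerm π) → cycles π ≡ cycleMaxima (reflect π)
cycles≡cycleMaxima-reflect {N} π isPerm-π = begin
  count (isCycleMin π) (finList N)
    ≡⟨ count-∘-bijection (isCycleMin π) opposite opposite (finList-unique N)
         Finₚ.opposite-involutive Finₚ.opposite-involutive (λ _ → ∈-finList _) (λ _ → ∈-finList _) ⟨
  count (isCycleMin π ∘ opposite) (finList N)
    ≡⟨ count-cong (finList N) (λ {i} _ → isCycleMin-opposite π isPerm-π i) ⟩
  count (isCycleMax (reflect π)) (finList N)
    ∎
  where open ≡-Reasoning

stirling1≡distribution-cycleMaxima : (s t : ℕ) → stirling1 s t ≡ distribution cycleMaxima (SymGroup s) t
stirling1≡distribution-cycleMaxima s t = begin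
  count (λ π → cycles π ≡ᵇ t) (SymGroup s)
    ≡⟨ count-cong (SymGroup s) (λ {π} π∈ → cong (_≡ᵇ t) (cycles≡cycleMaxima-reflect π (∈-SymGroup⁻ π∈))) ⟩
  count (λ π → cycleMaxima (reflect π) ≡ᵇ t) (SymGroup s)
    ≡⟨ count-∘-bijection (λ π → cycleMaxima π ≡ᵇ t) reflect reflect (SymGroup-unique s)
         reflect-involutive reflect-involutive reflect-∈-SymGroup reflect-∈-SymGroup ⟩
  count (λ π → cycleMaxima π ≡ᵇ t) (SymGroup s)
    ∎
  where open ≡-Reasoning

-- The Stirling recurrence

-- τ arises from π by cutting 0 out of its cycle (i ↦ 0 ↦ π 0 becomes i ↦ π 0) and lowering all other entries by one.
ZeroDeletion : {N : ℕ} → Vec (Fin (suc N)) (suc N) → Vec (Fin N) N → Set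
ZeroDeletion π τ = ∀ j → lookup π (suc j) ≡ suc (lookup τ j)
                       ⊎ (lookup π (suc j) ≡ zero × lookup π zero ≡ suc (lookup τ j))

module _ {N : ℕ} {π : Vec (Fin (suc N)) (suc N)} {τ : Vec (Fin N) N} (π⇝τ : ZeroDeletion π τ) (j : Fin N) where

  iter-zeroDeletion : ∀ t → (∃ λ s → iter π t (suc j) ≡ suc (iter τ s j))
                          ⊎ (iter π t (suc j) ≡ zero × ∃ λ s → lookup π zero ≡ suc (iter τ s j))
  iter-zeroDeletion zero = inj₁ (0 , refl)
  iter-zeroDeletion (suc t) with iter-zeroDeletion t
  ... | inj₂ (πᵗ≡0 , s , π0≡τˢ) = inj₁ (s , trans (cong (lookup π) πᵗ≡0) π0≡τˢ)
  ... | inj₁ (s , πᵗ≡τˢ) with π⇝τ (iter τ s j)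
  ...   | inj₁ π≡τ = inj₁ (suc s , trans (cong (lookup π) πᵗ≡τˢ) π≡τ)
  ...   | inj₂ (π≡0 , π0≡τ) = inj₂ (trans (cong (lookup π) πᵗ≡τˢ) π≡0 , suc s , π0≡τ)

  iter-zeroDeletion⁻¹ : ∀ s → ∃ λ t → iter π t (suc j) ≡ suc (iter τ s j)
  iter-zeroDeletion⁻¹ zero = 0 , refl
  iter-zeroDeletion⁻¹ (suc s) with t , πᵗ≡τˢ ← iter-zeroDeletion⁻¹ s with π⇝τ (iter τ s j)
  ... | inj₁ π≡τ = suc t , trans (cong (lookup π) πᵗ≡τˢ) π≡τ
  ... | inj₂ (π≡0 , π0≡τ) = suc (suc t) , trans (cong (lookup π) (trans (cong (lookup π) πᵗ≡τˢ) π≡0)) π0≡τ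

  CycleMax-zeroDeletion⁺ : CycleMax τ j → CycleMax π (suc j)
  CycleMax-zeroDeletion⁺ max t with iter-zeroDeletion t
  ... | inj₁ (s , πᵗ≡τˢ) rewrite πᵗ≡τˢ = s≤s (max s)
  ... | inj₂ (πᵗ≡0 , _) rewrite πᵗ≡0 = z≤n

  CycleMax-zeroDeletion⁻ : CycleMax π (suc j) → CycleMax τ j
  CycleMax-zeroDeletion⁻ max s with t , πᵗ≡τˢ ← iter-zeroDeletion⁻¹ s =
    ≤-pred (subst (λ y → toℕ y ≤ suc (toℕ j)) πᵗ≡τˢ (max t))

collapse : {N : ℕ} → Fin (suc N) → Fin N → Fin N
collapse zero y = y
collapse {suc N} (suc u) zero = u
collapse {suc N} (suc u) (suc y) = punchIn u y

uncollapse : {N : ℕ} → Fin (suc N) → Fin N → Fin N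
uncollapse zero z = z
uncollapse {suc N} (suc u) z with u Finₚ.≟ z
... | yes _ = zero
... | no u≢z = suc (punchOut u≢z)

collapse-uncollapse : {N : ℕ} (x : Fin (suc N)) (z : Fin N) → collapse x (uncollapse x z) ≡ z
collapse-uncollapse zero z = refl
collapse-uncollapse {suc N} (suc u) z with u Finₚ.≟ z
... | yes refl = refl
... | no u≢z = Finₚ.punchIn-punchOut u≢z

uncollapse-collapse : {N : ℕ} (x : Fin (suc N)) (y : Fin N) → uncollapse x (collapse x y) ≡ y
uncollapse-collapse zero y = refl
uncollapse-collapse {suc N} (suc u) zero with u Finₚ.≟ u
... | yes _ = refl
... | no u≢u = ⊥-elim (u≢u refl)
uncollapse-collapse {suc N} (suc u) (suc y) with u Finₚ.≟ punchIn u y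
... | yes u≡u↑y = ⊥-elim (Finₚ.punchInᵢ≢i u y (sym u≡u↑y))
... | no _ = cong suc (trans (Finₚ.punchOut-cong u refl) (Finₚ.punchOut-punchIn u))

collapse-injective : {N : ℕ} (x : Fin (suc N)) → Injective _≡_ _≡_ (collapse x)
collapse-injective x {a} {b} eq =
  trans (sym (uncollapse-collapse x a)) (trans (cong (uncollapse x) eq) (uncollapse-collapse x b))

punchIn-collapse : {N : ℕ} (x : Fin (suc N)) (y : Fin N) →
                   punchIn x y ≡ suc (collapse x y) ⊎ (punchIn x y ≡ zero × x ≡ suc (collapse x y))
punchIn-collapse zero y = inj₁ refl
punchIn-collapse {suc N} (suc u) zero = inj₂ (refl , refl)
punchIn-collapse {suc N} (suc u) (suc y) = inj₁ refl

◃-zeroDeletion : {N : ℕ} (x : Fin (suc N)) (σ : Vec (Fin N) N) → ZeroDeletion (x ◃ σ) (Vec.map (collapse x) σ)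
◃-zeroDeletion x σ j with punchIn-collapse x (lookup σ j)
... | inj₁ x↑σj≡ = inj₁ (trans (Vecₚ.lookup-map j (punchIn x) σ)
                                (trans x↑σj≡ (cong suc (sym (Vecₚ.lookup-map j (collapse x) σ)))))
... | inj₂ (x↑σj≡0 , x≡) = inj₂ ( trans (Vecₚ.lookup-map j (punchIn x) σ) x↑σj≡0
                                 , trans x≡ (cong suc (sym (Vecₚ.lookup-map j (collapse x) σ))) )

isCycleMax-◃-zero : {N : ℕ} (x : Fin (suc N)) {σ : Vec (Fin N) N} → σ ∈ SymGroup N →
                    isCycleMax (x ◃ σ) zero ≡ (toℕ x <ᵇ 1)
isCycleMax-◃-zero zero {σ} σ∈ =
  Equivalence.to T-≡ (isCycleMax⇐ (zero ◃ σ) (λ t → subst (λ y → toℕ y ≤ 0) (sym (fixed t)) z≤n))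
  where
  fixed : ∀ t → iter (zero ◃ σ) t zero ≡ zero
  fixed zero = refl
  fixed (suc t) = cong (lookup (zero ◃ σ)) (fixed t)
isCycleMax-◃-zero (suc u) {σ} σ∈ with isCycleMax (suc u ◃ σ) zero in max
... | false = refl
... | true with () ← isCycleMax⇒ (suc u ◃ σ) (∈-SymGroup⇒injective (◃-∈-SymGroup (suc u) σ∈))
                                 {zero} (subst T (sym max) _) 1

module _ {N : ℕ} (x : Fin (suc N)) {σ : Vec (Fin N) N} (σ∈ : σ ∈ SymGroup N) where

  isCycleMax-◃-suc : (j : Fin N) → isCycleMax (x ◃ σ) (suc j) ≡ isCycleMax (Vec.map (collapse x) σ) j
  isCycleMax-◃-suc j = T-ext
    (isCycleMax⇐ τ ∘ CycleMax-zeroDeletion⁻ (◃-zeroDeletion x σ) j ∘ isCycleMax⇒ (x ◃ σ) (∈-SymGroup⇒injective x◃σ∈))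
    (isCycleMax⇐ (x ◃ σ) ∘ CycleMax-zeroDeletion⁺ (◃-zeroDeletion x σ) j ∘ isCycleMax⇒ τ (∈-SymGroup⇒injective τ∈))
    where
    τ = Vec.map (collapse x) σ
    x◃σ∈ = ◃-∈-SymGroup x σ∈
    τ∈ = map-∈-SymGroup (collapse-injective x) σ∈

  cycleMaxima-◃ : cycleMaxima (x ◃ σ) ≡ fromBool (toℕ x <ᵇ 1) + cycleMaxima (Vec.map (collapse x) σ)
  cycleMaxima-◃ = trans (count-finList-suc (isCycleMax (x ◃ σ)))
    (cong₂ _+_ (cong fromBool (isCycleMax-◃-zero x σ∈)) (count-cong (finList N) (λ {j} _ → isCycleMax-◃-suc j)))

distribution-cycleMaxima-suc : (N t : ℕ) →
  distribution cycleMaxima (SymGroup (suc N)) t ≡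
  shift (distribution cycleMaxima (SymGroup N)) t + N * distribution cycleMaxima (SymGroup N) t
distribution-cycleMaxima-suc N t = begin
  distribution cycleMaxima (SymGroup (suc N)) t
    ≡⟨ distribution-SymGroup-suc {N} cycleMaxima (λ x → toℕ x <ᵇ 1) (λ x → cycleMaxima ∘ Vec.map (collapse x))
                                 cycleMaxima-◃ t ⟩
  sum (map (λ x → G′ x (toℕ x <ᵇ 1)) (finList (suc N)))
    ≡⟨ cong sum (Listₚ.map-cong (λ x → collapse-invariant x (toℕ x <ᵇ 1)) (finList (suc N))) ⟩
  sum (map (λ x → G (toℕ x <ᵇ 1)) (finList (suc N)))
    ≡⟨ sum-finList-<ᵇ (suc N) 1 (s≤s z≤n) G ⟩
  1 * G true + N * G false
    ≡⟨ cong (_+ N * G false) (trans (*-identityˡ (G true)) (distribution-suc cycleMaxima (SymGroup N) t)) ⟩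
  shift (distribution cycleMaxima (SymGroup N)) t + N * distribution cycleMaxima (SymGroup N) t
    ∎
  where
  open ≡-Reasoning
  G : Bool → ℕ
  G b = distribution (λ σ → fromBool b + cycleMaxima σ) (SymGroup N) t
  G′ : Fin (suc N) → Bool → ℕ
  G′ x b = distribution (λ σ → fromBool b + cycleMaxima (Vec.map (collapse x) σ)) (SymGroup N) t
  collapse-invariant : (x : Fin (suc N)) (b : Bool) → G′ x b ≡ G b
  collapse-invariant x b = count-∘-bijection (λ σ → (fromBool b + cycleMaxima σ) ≡ᵇ t)
    (Vec.map (collapse x)) (Vec.map (uncollapse x)) (SymGroup-unique N)
    (map-inverse (uncollapse-collapse x)) (map-inverse (collapse-uncollapse x))
    (map-∈-SymGroup (collapse-injective x)) (map-∈-SymGroup uncollapse-injective)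
    where
    uncollapse-injective : Injective _≡_ _≡_ (uncollapse x)
    uncollapse-injective {a} {b} eq =
      trans (sym (collapse-uncollapse x a)) (trans (cong (collapse x) eq) (collapse-uncollapse x b))

-- Solving the recurrences

vanishing-above-diagonal : (X : ℕ → ℕ → ℕ) (α β : ℕ → ℕ) → (∀ j → X 0 (suc j) ≡ 0) →
  (∀ m j → X (suc m) j ≡ α m * shift (X m) j + β m * X m j) → ∀ m j → m < j → X m j ≡ 0
vanishing-above-diagonal X α β X0 Xsuc zero (suc j) _ = X0 j
vanishing-above-diagonal X α β X0 Xsuc (suc m) (suc j) (s≤s m<j) = begin
  X (suc m) (suc j)                     ≡⟨ Xsuc m (suc j) ⟩
  α m * X m j + β m * X m (suc j)
    ≡⟨ cong₂ (λ a b → α m * a + β m * b) (vanish m j m<j) (vanish m (suc j) (m<n⇒m<1+n m<j)) ⟩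
  α m * 0 + β m * 0                     ≡⟨ cong₂ _+_ (*-zeroʳ (α m)) (*-zeroʳ (β m)) ⟩
  0                                     ∎
  where
  open ≡-Reasoning
  vanish = vanishing-above-diagonal X α β X0 Xsuc

cycleMaxDist : ℕ → ℕ → ℕ
cycleMaxDist s = distribution cycleMaxima (SymGroup s)

cycleMaxDist-suc : (s t : ℕ) → cycleMaxDist (suc s) t ≡ 1 * shift (cycleMaxDist s) t + s * cycleMaxDist s t
cycleMaxDist-suc s t = trans (distribution-cycleMaxima-suc s t) (cong (_+ s * cycleMaxDist s t) (sym (*-identityˡ _)))

cycleMaxDist-vanishes : (s t : ℕ) → s < t → cycleMaxDist s t ≡ 0
cycleMaxDist-vanishes = vanishing-above-diagonal cycleMaxDist (λ _ → 1) (λ s → s) (λ _ → refl) cycleMaxDist-suc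

cycleMaxDist-suc-zero : (s : ℕ) → cycleMaxDist (suc s) 0 ≡ 0
cycleMaxDist-suc-zero zero = refl
cycleMaxDist-suc-zero (suc s) =
  trans (cycleMaxDist-suc (suc s) 0) (trans (cong (suc s *_) (cycleMaxDist-suc-zero s)) (*-zeroʳ (suc s)))

private
  rearrange-diagonal : ∀ n m p c f → m * 0 + n * (p * c * f) ≡ n * p * c * f
  rearrange-diagonal = solve-∀
  rearrange-step : ∀ n M p a b f → suc M * (n * p * a * f) + n * (p * b * f) ≡ n * p * (1 * b + suc M * a) * f
  rearrange-step = solve-∀
  rearrange-column : ∀ n M c f → suc M * (1 * c * f) + n * 0 ≡ 1 * (1 * 0 + suc M * c) * f
  rearrange-column = solve-∀

module _ (n : ℕ) where

  cDist : ℕ → ℕ → ℕ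
  cDist m = distribution (cStat m) (SymGroup (m + n))

  cDist-zero-zero : cDist 0 0 ≡ n !
  cDist-zero-zero = trans (count-true (SymGroup n)) (length-SymGroup n)

  cDist-suc : (m j : ℕ) → cDist (suc m) j ≡ suc m * shift (cDist m) j + n * cDist m j
  cDist-suc m j = trans (distribution-cStat-suc (m + n) m j (m≤m+n m n))
    (cong (λ d → suc m * shift (cDist m) j + d * cDist m j) (m+n∸m≡n m n))

  cDist-vanishes : (m j : ℕ) → m < j → cDist m j ≡ 0
  cDist-vanishes = vanishing-above-diagonal cDist suc (λ _ → n) (λ _ → count-false (SymGroup n)) cDist-suc

  -- Indexed by m = j + k so that the induction never meets truncated subtraction.
  cDist-formula : (j k : ℕ) → cDist (j + k) j ≡ n ^ k * cycleMaxDist (suc (j + k)) (suc k) * n !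
  cDist-formula zero zero = trans cDist-zero-zero (sym (+-identityʳ (n !)))
  cDist-formula zero (suc k) = begin
    cDist (suc k) 0
      ≡⟨ cDist-suc k 0 ⟩
    suc k * 0 + n * cDist k 0
      ≡⟨ cong (λ d → suc k * 0 + n * d) (cDist-formula zero k) ⟩
    suc k * 0 + n * (n ^ k * cycleMaxDist (suc k) (suc k) * n !)
      ≡⟨ rearrange-diagonal n (suc k) (n ^ k) (cycleMaxDist (suc k) (suc k)) (n !) ⟩
    n ^ suc k * cycleMaxDist (suc k) (suc k) * n !
      ≡⟨ cong (λ c → n ^ suc k * c * n !) diagonal ⟩
    n ^ suc k * cycleMaxDist (suc (suc k)) (suc (suc k)) * n !
      ∎
    where
    open ≡-Reasoning
    diagonal : cycleMaxDist (suc k) (suc k) ≡ cycleMaxDist (suc (suc k)) (suc (suc k))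
    diagonal = sym (begin
      cycleMaxDist (suc (suc k)) (suc (suc k))
        ≡⟨ cycleMaxDist-suc (suc k) (suc (suc k)) ⟩
      1 * cycleMaxDist (suc k) (suc k) + suc k * cycleMaxDist (suc k) (suc (suc k))
        ≡⟨ cong₂ (λ a b → a + suc k * b) (*-identityˡ _) (cycleMaxDist-vanishes (suc k) (suc (suc k)) ≤-refl) ⟩
      cycleMaxDist (suc k) (suc k) + suc k * 0
        ≡⟨ cong (cycleMaxDist (suc k) (suc k) +_) (*-zeroʳ (suc k)) ⟩
      cycleMaxDist (suc k) (suc k) + 0
        ≡⟨ +-identityʳ _ ⟩
      cycleMaxDist (suc k) (suc k)
        ∎)
  cDist-formula (suc j) zero = begin
    cDist (suc M) (suc j)
      ≡⟨ cDist-suc M (suc j) ⟩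
    suc M * cDist M j + n * cDist M (suc j)
      ≡⟨ cong₂ (λ a b → suc M * a + n * b) (cDist-formula j 0) (cDist-vanishes M (suc j) M<1+j) ⟩
    suc M * (1 * cycleMaxDist (suc M) 1 * n !) + n * 0
      ≡⟨ rearrange-column n M (cycleMaxDist (suc M) 1) (n !) ⟩
    1 * (1 * 0 + suc M * cycleMaxDist (suc M) 1) * n !
      ≡⟨ cong (λ c → 1 * (1 * c + suc M * cycleMaxDist (suc M) 1) * n !) (cycleMaxDist-suc-zero M) ⟨
    1 * (1 * cycleMaxDist (suc M) 0 + suc M * cycleMaxDist (suc M) 1) * n !
      ≡⟨ cong (λ c → 1 * c * n !) (cycleMaxDist-suc (suc M) 1) ⟨
    1 * cycleMaxDist (suc (suc M)) 1 * n !
      ∎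
    where
    open ≡-Reasoning
    M = j + 0
    M<1+j : M < suc j
    M<1+j = s≤s (≤-reflexive (+-identityʳ j))
  cDist-formula (suc j) (suc k) = begin
    cDist (suc M) (suc j)
      ≡⟨ cDist-suc M (suc j) ⟩
    suc M * cDist M j + n * cDist M (suc j)
      ≡⟨ cong₂ (λ a b → suc M * a + n * b) (cDist-formula j (suc k)) shifted ⟩
    suc M * (n ^ suc k * cycleMaxDist (suc M) (suc (suc k)) * n !) + n * (n ^ k * cycleMaxDist (suc M) (suc k) * n !)
      ≡⟨ rearrange-step n M (n ^ k) (cycleMaxDist (suc M) (suc (suc k))) (cycleMaxDist (suc M) (suc k)) (n !) ⟩
    n ^ suc k * (1 * cycleMaxDist (suc M) (suc k) + suc M * cycleMaxDist (suc M) (suc (suc k))) * n !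
      ≡⟨ cong (λ c → n ^ suc k * c * n !) (cycleMaxDist-suc (suc M) (suc (suc k))) ⟨
    n ^ suc k * cycleMaxDist (suc (suc M)) (suc (suc k)) * n !
      ∎
    where
    open ≡-Reasoning
    M = j + suc k
    shifted : cDist M (suc j) ≡ n ^ k * cycleMaxDist (suc M) (suc k) * n !
    shifted = subst (λ m → cDist m (suc j) ≡ n ^ k * cycleMaxDist (suc m) (suc k) * n !)
                    (sym (+-suc j k)) (cDist-formula (suc j) k)

  cDist-formula-∸ : (m k : ℕ) → k ≤ m → cDist m (m ∸ k) ≡ n ^ k * cycleMaxDist (suc m) (suc k) * n !
  cDist-formula-∸ m k k≤m = subst (λ m′ → cDist m′ (m ∸ k) ≡ n ^ k * cycleMaxDist (suc m′) (suc k) * n !)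
    (m∸n+n≡m k≤m) (cDist-formula (m ∸ k) k)

proposition2p1 : (m n k : ℕ) → m ≥ 1 → n ≥ 1 → k ≤ m →
    cmnk m n k ≡ n ^ k * stirling1 (m + 1) (k + 1) * n !
proposition2p1 m n k _ _ k≤m = begin
  cDist n m (m ∸ k)                          ≡⟨ cDist-formula-∸ n m k k≤m ⟩
  n ^ k * cycleMaxDist (suc m) (suc k) * n ! ≡⟨ cong (λ s → n ^ k * s * n !) stirling1≡cycleMaxDist ⟨
  n ^ k * stirling1 (m + 1) (k + 1) * n !    ∎
  where
  open ≡-Reasoning
  stirling1≡cycleMaxDist : stirling1 (m + 1) (k + 1) ≡ cycleMaxDist (suc m) (suc k)
  stirling1≡cycleMaxDist =
    trans (cong₂ stirling1 (+-comm m 1) (+-comm k 1)) (stirling1≡distribution-cycleMaxima (suc m) (suc k))
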